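{- Let $TBool_n$ denote the set of TSSCPP boolean triangles of order $n$ partially ordered by reverse componentwise comparison. Then $TBool_n$ is a lattice for $n\le 3$, but for every $n\geq 4$ it is not a lattice.
   Context: A TSSCPP boolean triangle of order $n$ is an array $\{b_{i,j}\}$ indexed by $1\leq i\leq n-1$, $n-i\leq j\leq n-1$, with entries in $\{0,1\}$, such that for all $j$ and all $i'$ with $j\le i'\le n-1$, $$1+\sum_{i=j+1}^{i'} b_{i,n-j-1} \;\geq\; \sum_{i=j}^{i'} b_{i,n-j},$$ where sums over empty index ranges are $0$. Reverse componentwise comparison: $b\le b'$ if and only if $b_{i,j}\ge b'_{i,j}$ for all indices $(i,j)$. -}

module Defs where

open import Data.Nat using (ℕ; zero; suc; _+_; _∸_; _≤_; _<_; _≤?_; _<?_)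
open import Data.Bool using (Bool; true; false; if_then_else_)
import Data.Bool as B
open import Data.List using (map; applyUpTo)
open import Data.Nat.ListAction using (sum)
open import Data.Product using (Σ; ∃; _×_; _,_; proj₁)
open import Relation.Nullary using (¬_; yes; no)

record Idx (n : ℕ) : Set where
  constructor idx
  field
    i    : ℕ
    j    : ℕ
    1≤i  : 1 ≤ i
    i<n  : i < n
    n-i≤j : n ∸ i ≤ j
    j<n  : j < n

Triangle : ℕ → Set
Triangle n = Idx n → Bool

-- The numerical value b_{i,j} ∈ {0,1}; only ever used at valid indices
-- (out-of-range arguments give 0, but never occur in the defining sums).
entry : {n : ℕ} → Triangle n → ℕ → ℕ → ℕ
entry {n} b i j with 1 ≤? i | i <? n | n ∸ i ≤? j | j <? n
... | yes p | yes q | yes r | yes s = if b (idx i j p q r s) then 1 else 0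
... | _ | _ | _ | _ = 0

-- Σ_{i=a}^{c} f i  (empty, i.e. 0, when c < a)
sumFromTo : (ℕ → ℕ) → ℕ → ℕ → ℕ
sumFromTo f a c = sum (map f (applyUpTo (a +_) (suc c ∸ a)))

-- The TSSCPP condition: for all j and all i' with j ≤ i' ≤ n-1,
--   1 + Σ_{i=j+1}^{i'} b_{i,n-j-1} ≥ Σ_{i=j}^{i'} b_{i,n-j}.
-- (j ranges over 1 ≤ j, so that column n-j is within the triangle.)
IsTSSCPP : {n : ℕ} → Triangle n → Set
IsTSSCPP {n} b =
  ∀ (j i' : ℕ) → 1 ≤ j → j ≤ i' → i' < n →
    sumFromTo (λ i → entry b i (n ∸ j)) j i'
      ≤ 1 + sumFromTo (λ i → entry b i (n ∸ j ∸ 1)) (suc j) i'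

TBool : ℕ → Set
TBool n = Σ (Triangle n) IsTSSCPP

_≼_ : {n : ℕ} → TBool n → TBool n → Set
_≼_ {n} (b , _) (b' , _) = ∀ (k : Idx n) → b' k B.≤ b k

IsJoin : {n : ℕ} → TBool n → TBool n → TBool n → Set
IsJoin {n} x y z = (x ≼ z) × (y ≼ z) × (∀ (w : TBool n) → x ≼ w → y ≼ w → z ≼ w)

IsMeet : {n : ℕ} → TBool n → TBool n → TBool n → Set
IsMeet {n} x y z = (z ≼ x) × (z ≼ y) × (∀ (w : TBool n) → w ≼ x → w ≼ y → w ≼ z)

IsLatticeTBool : ℕ → Set
IsLatticeTBool n = ∀ (x y : TBool n) → (∃ λ z → IsJoin x y z) × (∃ λ z → IsMeet x y z)

module Submission where

-- Pointwise conjunction of two valid triangles is always valid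
-- and is their join for the reversed order.  Meets are obtained from a closure
-- operator: the smallest valid triangle lying pointwise above the disjunction
-- (lattice-from-closure).  For n ≤ 2 every triangle is valid, so the closure is
-- the identity; for n = 3 the single nontrivial condition is b₁₂ ∧ b₂₂ ≤ b₂₁,
-- and the closure switches on b₂₁ when it is forced.
--
-- Triangles are written in local coordinates (row i, column
-- n ∸ c), so one finite pattern near the right edge is a valid triangle for
-- every n once five concrete inequalities are checked (embed-valid,
-- box-suffices).  The patterns X (one at row 1) and Y (one at row 3) have the
-- incomparable common lower bounds Z₁ and Z₂.  A meet z of X and Y would lie
-- pointwise between X ∨ Y and Z₁ ∧ Z₂, which forces entries making the
-- condition (j = 1, i' = 3) read 2 ≤ 1.

open import Defs
open import Data.Nat using (ℕ; zero; suc; _+_; _∸_; _≤_; _<_; z≤n; s≤s; _≤?_; _<?_)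
open import Data.Nat.Properties
open import Data.Bool using (Bool; true; false; _∧_; _∨_; if_then_else_)
import Data.Bool as B
import Data.Bool.Properties as BP
open import Data.List using (map; applyUpTo)
open import Data.Nat.ListAction using (sum)
open import Data.Product using (_×_; _,_; proj₁; proj₂; uncurry)
open import Data.Sum using (inj₁; inj₂)
open import Data.Empty using (⊥; ⊥-elim)
open import Relation.Nullary using (¬_; yes; no)
open import Relation.Nullary.Decidable using (True; toWitness)
open import Relation.Binary.PropositionalEquality

by-computation : ∀ {m n} {w : True (m ≤? n)} → m ≤ n
by-computation {w = w} = toWitness w

∧-lowerˡ : ∀ a b → a ∧ b B.≤ a
∧-lowerˡ false b = B.b≤b
∧-lowerˡ true  b = BP.≤-maximum b

∧-lowerʳ : ∀ a b → a ∧ b B.≤ b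
∧-lowerʳ false b = BP.≤-minimum b
∧-lowerʳ true  b = B.b≤b

∧-greatest : ∀ {a b c} → c B.≤ a → c B.≤ b → c B.≤ a ∧ b
∧-greatest {false} B.b≤b _ = B.b≤b
∧-greatest {true}  _     q = q

∧-mono : ∀ {a b c d} → a B.≤ b → c B.≤ d → a ∧ c B.≤ b ∧ d
∧-mono {a} {c = c} p q =
  ∧-greatest (BP.≤-trans (∧-lowerˡ a c) p) (BP.≤-trans (∧-lowerʳ a c) q)

∨-upperˡ : ∀ a b → a B.≤ a ∨ b
∨-upperˡ false b = BP.≤-minimum b
∨-upperˡ true  b = B.b≤b

∨-upperʳ : ∀ a b → b B.≤ a ∨ b
∨-upperʳ false b = B.b≤b
∨-upperʳ true  b = BP.≤-maximum b

∨-least : ∀ {a b c} → a B.≤ c → b B.≤ c → a ∨ b B.≤ c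
∨-least {false} _ q = q
∨-least {true}  p _ = p

toN : Bool → ℕ
toN b = if b then 1 else 0

toN-mono : ∀ {a b} → a B.≤ b → toN a ≤ toN b
toN-mono B.f≤t = z≤n
toN-mono B.b≤b = ≤-refl

toN≤1 : ∀ b → toN b ≤ 1
toN≤1 false = z≤n
toN≤1 true  = ≤-refl

-- Finite sums.  sumFromTo f a c unfolds to sum (map f (applyUpTo (a +_) k)),
-- so the basic facts are proved for an arbitrary generator g.

sumUpTo-mono : (f h g : ℕ → ℕ) (k : ℕ) → (∀ t → t < k → f (g t) ≤ h (g t)) →
               sum (map f (applyUpTo g k)) ≤ sum (map h (applyUpTo g k))
sumUpTo-mono f h g zero    _ = z≤n
sumUpTo-mono f h g (suc k) H =
  +-mono-≤ (H 0 (s≤s z≤n)) (sumUpTo-mono f h (λ t → g (suc t)) k (λ t t<k → H (suc t) (s≤s t<k)))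

sumUpTo-zero : (f g : ℕ → ℕ) (k : ℕ) → (∀ t → f (g t) ≡ 0) → sum (map f (applyUpTo g k)) ≡ 0
sumUpTo-zero f g zero    _ = refl
sumUpTo-zero f g (suc k) H rewrite H 0 = sumUpTo-zero f (λ t → g (suc t)) k (λ t → H (suc t))

sumUpTo-drop : (f g : ℕ → ℕ) (k d : ℕ) → (∀ t → k ≤ t → f (g t) ≡ 0) →
               sum (map f (applyUpTo g (k + d))) ≡ sum (map f (applyUpTo g k))
sumUpTo-drop f g zero    d H = sumUpTo-zero f g d (λ t → H t z≤n)
sumUpTo-drop f g (suc k) d H =
  cong (f (g 0) +_) (sumUpTo-drop f (λ t → g (suc t)) k d (λ t k≤t → H (suc t) (s≤s k≤t)))

summand-in-range : ∀ a c t → t < suc c ∸ a → a + t ≤ c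
summand-in-range zero          c       t (s≤s t≤c) = t≤c
summand-in-range (suc a)       (suc c) t lt        = s≤s (summand-in-range a c t lt)
summand-in-range (suc zero)    zero    t ()
summand-in-range (suc (suc a)) zero    t ()

sumFromTo-mono : {f h : ℕ → ℕ} (a c : ℕ) → (∀ i → a ≤ i → i ≤ c → f i ≤ h i) →
                 sumFromTo f a c ≤ sumFromTo h a c
sumFromTo-mono {f} {h} a c H = sumUpTo-mono f h (a +_) (suc c ∸ a)
  (λ t lt → H (a + t) (m≤m+n a t) (summand-in-range a c t lt))

sumFromTo-cong : {f h : ℕ → ℕ} (a c : ℕ) → (∀ i → a ≤ i → i ≤ c → f i ≡ h i) →
                 sumFromTo f a c ≡ sumFromTo h a c
sumFromTo-cong a c H =
  ≤-antisym (sumFromTo-mono a c (λ i p q → ≤-reflexive (H i p q)))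
            (sumFromTo-mono a c (λ i p q → ≤-reflexive (sym (H i p q))))

sumFromTo-zero : {f : ℕ → ℕ} (a c : ℕ) → (∀ i → f i ≡ 0) → sumFromTo f a c ≡ 0
sumFromTo-zero {f} a c H = sumUpTo-zero f (a +_) (suc c ∸ a) (λ t → H (a + t))

sumFromTo-truncate : {f : ℕ → ℕ} (a m c : ℕ) → (∀ i → m < i → f i ≡ 0) → m ≤ c →
                     sumFromTo f a c ≡ sumFromTo f a m
sumFromTo-truncate {f} a m c H m≤c =
  trans (cong (λ k → sum (map f (applyUpTo (a +_) k))) (sym (m+[n∸m]≡n short≤long)))
        (sumUpTo-drop f (a +_) (suc m ∸ a) _
          (λ t k≤t → H (a + t) (≤-trans (m≤n+m∸n (suc m) a) (+-monoʳ-≤ a k≤t))))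
  where
    short≤long : suc m ∸ a ≤ suc c ∸ a
    short≤long = ∸-monoˡ-≤ a (s≤s m≤c)

idx-≡ : ∀ {n i j} {p p' : 1 ≤ i} {q q' : i < n} {r r' : n ∸ i ≤ j} {s s' : j < n} →
        idx i j p q r s ≡ idx i j p' q' r' s'
idx-≡ {p = p} {p'} {q} {q'} {r} {r'} {s} {s'}
  rewrite ≤-irrelevant p p' | ≤-irrelevant q q' | ≤-irrelevant r r' | ≤-irrelevant s s' = refl

entry-at : {n : ℕ} (b : Triangle n) (k : Idx n) → entry b (Idx.i k) (Idx.j k) ≡ toN (b k)
entry-at {n} b (idx i j p q r s) with 1 ≤? i | i <? n | n ∸ i ≤? j | j <? n
... | yes _ | yes _ | yes _ | yes _ = cong (λ k → toN (b k)) idx-≡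
... | no ¬p | _     | _     | _     = ⊥-elim (¬p p)
... | yes _ | no ¬q | _     | _     = ⊥-elim (¬q q)
... | yes _ | yes _ | no ¬r | _     = ⊥-elim (¬r r)
... | yes _ | yes _ | yes _ | no ¬s = ⊥-elim (¬s s)

-- Outside the triangle entry is 0, so a bound valid at every index bounds entry everywhere.
entry-≤ : {n : ℕ} (b : Triangle n) (f : ℕ → ℕ → ℕ) →
          (∀ k → toN (b k) ≤ f (Idx.i k) (Idx.j k)) → ∀ i c → entry b i c ≤ f i c
entry-≤ {n} b f bound i c with 1 ≤? i | i <? n | n ∸ i ≤? c | c <? n
... | yes p | yes q | yes r | yes s = bound (idx i c p q r s)
... | no _  | _     | _     | _     = z≤n
... | yes _ | no _  | _     | _     = z≤n
... | yes _ | yes _ | no _  | _     = z≤n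
... | yes _ | yes _ | yes _ | no _  = z≤n

entry≤1 : {n : ℕ} (b : Triangle n) (i c : ℕ) → entry b i c ≤ 1
entry≤1 b = entry-≤ b (λ _ _ → 1) (λ k → toN≤1 (b k))

-- Pointwise order of boolean triangles; x ≼ y unfolds to proj₁ y ⊑ proj₁ x.
_⊑_ : {n : ℕ} → Triangle n → Triangle n → Set
b ⊑ c = ∀ k → b k B.≤ c k

lattice-from-closure : {n : ℕ} →
  (∀ x y → IsTSSCPP x → IsTSSCPP y → IsTSSCPP (λ k → x k ∧ y k)) →
  (close : Triangle n → Triangle n) →
  (∀ b → IsTSSCPP (close b)) →
  (∀ b → b ⊑ close b) →
  (∀ b (w : TBool n) → b ⊑ proj₁ w → close b ⊑ proj₁ w) →
  IsLatticeTBool n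
lattice-from-closure ∧-valid close close-valid extensive least (x , vx) (y , vy) =
  ( (((λ k → x k ∧ y k) , ∧-valid x y vx vy)
    , (λ k → ∧-lowerˡ (x k) (y k)) , (λ k → ∧-lowerʳ (x k) (y k))
    , λ _ p q k → ∧-greatest (p k) (q k))
  , ((close x∨y , close-valid x∨y)
    , (λ k → BP.≤-trans (∨-upperˡ (x k) (y k)) (extensive x∨y k))
    , (λ k → BP.≤-trans (∨-upperʳ (x k) (y k)) (extensive x∨y k))
    , λ w p q → least x∨y w (λ k → ∨-least (p k) (q k))))
  where
    x∨y : Triangle _
    x∨y k = x k ∨ y k

-- Orders n ≤ 2: the only condition (n = 2, j = i' = 1) says one entry is ≤ 1.

all-valid≤2 : (n : ℕ) → n ≤ 2 → (b : Triangle n) → IsTSSCPP b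
all-valid≤2 0 _ b _ _ _ _ ()
all-valid≤2 1 _ b zero    _        () _ _
all-valid≤2 1 _ b (suc _) zero     _  () _
all-valid≤2 1 _ b _       (suc _)  _  _  (s≤s ())
all-valid≤2 2 _ b 1 1 _ _ _ = +-monoˡ-≤ 0 (entry≤1 b 1 1)
all-valid≤2 2 _ b zero          _ () _ _
all-valid≤2 2 _ b 1             0 _ () _
all-valid≤2 2 _ b 1 (suc (suc _)) _ _ (s≤s (s≤s ()))
all-valid≤2 2 _ b (suc (suc _)) _ _ (s≤s (s≤s _)) (s≤s (s≤s ()))
all-valid≤2 (suc (suc (suc _))) (s≤s (s≤s ())) _

lattice≤2 : (n : ℕ) → n ≤ 2 → IsLatticeTBool n
lattice≤2 n n≤2 =
  lattice-from-closure (λ x y _ _ → all-valid≤2 n n≤2 _) (λ b → b) (all-valid≤2 n n≤2)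
                       (λ _ _ → BP.≤-refl) (λ _ _ b⊑w → b⊑w)

k12 k21 k22 : Idx 3
k12 = idx 1 2 (s≤s z≤n) (s≤s (s≤s z≤n)) (s≤s (s≤s z≤n)) (s≤s (s≤s (s≤s z≤n)))
k21 = idx 2 1 (s≤s z≤n) (s≤s (s≤s (s≤s z≤n))) (s≤s z≤n) (s≤s (s≤s z≤n))
k22 = idx 2 2 (s≤s z≤n) (s≤s (s≤s (s≤s z≤n))) (s≤s z≤n) (s≤s (s≤s (s≤s z≤n)))

idx3-elim : (P : Idx 3 → Set) → P k12 → P k21 → P k22 → ∀ k → P k
idx3-elim P p12 p21 p22 (idx 1 2 _ _ _ _) = subst P idx-≡ p12
idx3-elim P p12 p21 p22 (idx 2 1 _ _ _ _) = subst P idx-≡ p21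
idx3-elim P p12 p21 p22 (idx 2 2 _ _ _ _) = subst P idx-≡ p22
idx3-elim P _ _ _ (idx 0 _ () _ _ _)
idx3-elim P _ _ _ (idx (suc (suc (suc _))) _ _ (s≤s (s≤s (s≤s ()))) _ _)
idx3-elim P _ _ _ (idx 1 0 _ _ () _)
idx3-elim P _ _ _ (idx 1 1 _ _ (s≤s ()) _)
idx3-elim P _ _ _ (idx 1 (suc (suc (suc _))) _ _ _ (s≤s (s≤s (s≤s ()))))
idx3-elim P _ _ _ (idx 2 0 _ _ () _)
idx3-elim P _ _ _ (idx 2 (suc (suc (suc _))) _ _ _ (s≤s (s≤s (s≤s ()))))

-- The condition j = 1, i' = 2 for n = 3, b₁₂ + b₂₂ ≤ 1 + b₂₁, as a boolean inequality.
Closed3 : Triangle 3 → Set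
Closed3 b = b k12 ∧ b k22 B.≤ b k21

count⇒closed : ∀ u w v → toN u + (toN w + 0) ≤ 1 + (toN v + 0) → u ∧ w B.≤ v
count⇒closed false w     v     _ = BP.≤-minimum v
count⇒closed true  false v     _ = BP.≤-minimum v
count⇒closed true  true  true  _ = B.b≤b
count⇒closed true  true  false (s≤s ())

closed⇒count : ∀ u w v → u ∧ w B.≤ v → toN u + (toN w + 0) ≤ 1 + (toN v + 0)
closed⇒count false false v _     = z≤n
closed⇒count false true  v _     = s≤s z≤n
closed⇒count true  false v _     = s≤s z≤n
closed⇒count true  true  v B.b≤b = ≤-refl

closed⇒valid3 : (b : Triangle 3) → Closed3 b → IsTSSCPP b
closed⇒valid3 b _ 1 1 _ _ _ = +-monoˡ-≤ 0 (entry≤1 b 1 2)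
closed⇒valid3 b c 1 2 _ _ _ = closed⇒count (b k12) (b k22) (b k21) c
closed⇒valid3 b _ 2 2 _ _ _ = +-monoˡ-≤ 0 (entry≤1 b 2 1)
closed⇒valid3 b _ 0 _ () _ _
closed⇒valid3 b _ 1 0 _ () _
closed⇒valid3 b _ 2 0 _ () _
closed⇒valid3 b _ 2 1 _ (s≤s ()) _
closed⇒valid3 b _ _ (suc (suc (suc _))) _ _ (s≤s (s≤s (s≤s ())))
closed⇒valid3 b _ (suc (suc (suc _))) _ _ j≤i' i'<3 =
  ⊥-elim (<⇒≱ i'<3 (≤-trans (s≤s (s≤s (s≤s z≤n))) j≤i'))

valid3⇒closed : (b : Triangle 3) → IsTSSCPP b → Closed3 b
valid3⇒closed b valid =
  count⇒closed (b k12) (b k22) (b k21) (valid 1 2 (s≤s z≤n) (s≤s z≤n) (s≤s (s≤s (s≤s z≤n))))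

close3 : Triangle 3 → Triangle 3
close3 b (idx 2 1 _ _ _ _) = b k21 ∨ (b k12 ∧ b k22)
close3 b k                 = b k

lattice3 : IsLatticeTBool 3
lattice3 = lattice-from-closure ∧-valid close3 close-valid extensive least
  where
    ∧-valid : ∀ x y → IsTSSCPP x → IsTSSCPP y → IsTSSCPP (λ k → x k ∧ y k)
    ∧-valid x y vx vy = closed⇒valid3 _
      (∧-greatest (BP.≤-trans (∧-mono (∧-lowerˡ (x k12) (y k12)) (∧-lowerˡ (x k22) (y k22)))
                              (valid3⇒closed x vx))
                  (BP.≤-trans (∧-mono (∧-lowerʳ (x k12) (y k12)) (∧-lowerʳ (x k22) (y k22)))
                              (valid3⇒closed y vy)))
    close-valid : ∀ b → IsTSSCPP (close3 b)
    close-valid b = closed⇒valid3 (close3 b) (∨-upperʳ (b k21) _)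
    extensive : ∀ b → b ⊑ close3 b
    extensive b = idx3-elim (λ k → b k B.≤ close3 b k) B.b≤b (∨-upperˡ _ _) B.b≤b
    least : ∀ b (w : TBool 3) → b ⊑ proj₁ w → close3 b ⊑ proj₁ w
    least b (w , vw) b⊑w = idx3-elim (λ k → close3 b k B.≤ w k) (b⊑w k12)
      (∨-least (b⊑w k21) (BP.≤-trans (∧-mono (b⊑w k12) (b⊑w k22)) (valid3⇒closed w vw)))
      (b⊑w k22)

embed : {n : ℕ} → (ℕ → ℕ → Bool) → Triangle n
embed {n} P (idx i j _ _ _ _) = P i (n ∸ j)

LocalCondition : (ℕ → ℕ → Bool) → ℕ → ℕ → Set
LocalCondition P j i' =
  sumFromTo (λ i → toN (P i j)) j i' ≤ 1 + sumFromTo (λ i → toN (P i (suc j))) (suc j) i'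

LocallyValid : (ℕ → ℕ → Bool) → Set
LocallyValid P = ∀ j i' → 1 ≤ j → j ≤ i' → LocalCondition P j i'

-- A locally valid P is a TSSCPP triangle for every n.  Truncation by the
-- triangle only removes entries on the left of the condition; the entries on
-- the right all lie inside the triangle.
embed-valid : {n : ℕ} (P : ℕ → ℕ → Bool) → LocallyValid P → IsTSSCPP (embed {n} P)
embed-valid {n} P ok j i' 1≤j j≤i' i'<n = begin
    sumFromTo (λ i → entry (embed P) i (n ∸ j)) j i'
  ≤⟨ sumFromTo-mono j i' (λ i _ _ → entry-≤ (embed P) (λ i c → toN (P i (n ∸ c)))
                                              (λ { (idx _ _ _ _ _ _) → ≤-refl }) i (n ∸ j)) ⟩
    sumFromTo (λ i → toN (P i (n ∸ (n ∸ j)))) j i'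
  ≡⟨ cong (λ c → sumFromTo (λ i → toN (P i c)) j i') (m∸[m∸n]≡n (<⇒≤ j<n)) ⟩
    sumFromTo (λ i → toN (P i j)) j i'
  ≤⟨ ok j i' 1≤j j≤i' ⟩
    1 + sumFromTo (λ i → toN (P i (suc j))) (suc j) i'
  ≡⟨ cong (1 +_) (sumFromTo-cong (suc j) i' right-entry) ⟨
    1 + sumFromTo (λ i → entry (embed P) i (n ∸ j ∸ 1)) (suc j) i'
  ∎
  where
    open ≤-Reasoning
    j<n : j < n
    j<n = ≤-<-trans j≤i' i'<n
    column : n ∸ j ∸ 1 ≡ n ∸ suc j
    column = trans (∸-+-assoc n j 1) (cong (n ∸_) (+-comm j 1))
    right-entry : ∀ i → suc j ≤ i → i ≤ i' → entry (embed P) i (n ∸ j ∸ 1) ≡ toN (P i (suc j))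
    right-entry i j<i i≤i' = begin-equality
        entry (embed P) i (n ∸ j ∸ 1)
      ≡⟨ entry-at (embed P) (idx i (n ∸ j ∸ 1) (≤-trans (s≤s z≤n) j<i) (≤-<-trans i≤i' i'<n)
                  (subst (n ∸ i ≤_) (sym column) (∸-monoʳ-≤ n j<i))
                  (subst (_< n) (sym column) (∸-monoʳ-< (s≤s z≤n) j<n))) ⟩
        toN (P i (n ∸ (n ∸ j ∸ 1)))
      ≡⟨ cong (λ c → toN (P i (n ∸ c))) column ⟩
        toN (P i (n ∸ (n ∸ suc j)))
      ≡⟨ cong (λ c → toN (P i c)) (m∸[m∸n]≡n j<n) ⟩
        toN (P i (suc j))
      ∎

-- The conditions that can be nontrivial for a pattern in rows ≤ 3 and local columns ≤ 2.
BoxConditions : (ℕ → ℕ → Bool) → Set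
BoxConditions P = LocalCondition P 1 1 × LocalCondition P 1 2 × LocalCondition P 1 3
                × LocalCondition P 2 2 × LocalCondition P 2 3

box-cases : (P : ℕ → ℕ → Bool) → BoxConditions P →
            ∀ j i' → 1 ≤ j → j ≤ 2 → j ≤ i' → i' ≤ 3 → LocalCondition P j i'
box-cases _ (h11 , _ , _ , _ , _) 1 1 _ _ _ _ = h11
box-cases _ (_ , h12 , _ , _ , _) 1 2 _ _ _ _ = h12
box-cases _ (_ , _ , h13 , _ , _) 1 3 _ _ _ _ = h13
box-cases _ (_ , _ , _ , h22 , _) 2 2 _ _ _ _ = h22
box-cases _ (_ , _ , _ , _ , h23) 2 3 _ _ _ _ = h23
box-cases _ _ 0 _ () _ _ _
box-cases _ _ (suc (suc (suc _))) _ _ (s≤s (s≤s ())) _ _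
box-cases _ _ 1 0 _ _ () _
box-cases _ _ 2 0 _ _ () _
box-cases _ _ 2 1 _ _ (s≤s ()) _
box-cases _ _ _ (suc (suc (suc (suc _)))) _ _ _ (s≤s (s≤s (s≤s ())))

-- For such a pattern the box conditions imply local validity: columns
-- beyond 2 contribute nothing, and rows beyond 3 do not change the sums.
box-suffices : (P : ℕ → ℕ → Bool) → (∀ i c → 3 < i → P i c ≡ false) →
               (∀ i c → 2 < c → P i c ≡ false) → BoxConditions P → LocallyValid P
box-suffices P rows cols box j i' 1≤j j≤i' with j ≤? 2 | i' ≤? 3
... | no j≰2 | _ =
  ≤-trans (≤-reflexive (sumFromTo-zero j i' (λ i → cong toN (cols i j (≰⇒> j≰2))))) z≤n
... | yes j≤2 | yes i'≤3 = box-cases P box j i' 1≤j j≤2 j≤i' i'≤3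
... | yes j≤2 | no i'≰3 =
  subst₂ (λ l r → l ≤ 1 + r) (sym (up-to-row3 j j)) (sym (up-to-row3 (suc j) (suc j)))
         (box-cases P box j 3 1≤j j≤2 (≤-trans j≤2 (n≤1+n 2)) ≤-refl)
  where
    up-to-row3 : ∀ a c → sumFromTo (λ i → toN (P i c)) a i' ≡ sumFromTo (λ i → toN (P i c)) a 3
    up-to-row3 a c = sumFromTo-truncate a 3 i' (λ i 3<i → cong toN (rows i c 3<i)) (<⇒≤ (≰⇒> i'≰3))

record Pattern : Set where
  constructor cells
  field
    c11 c21 c31 c22 c32 : Bool

cell : Pattern → ℕ → ℕ → Bool
cell p 1 1 = Pattern.c11 p
cell p 2 1 = Pattern.c21 p
cell p 3 1 = Pattern.c31 p
cell p 2 2 = Pattern.c22 p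
cell p 3 2 = Pattern.c32 p
cell p _ _ = false

cell-rows : ∀ p i c → 3 < i → cell p i c ≡ false
cell-rows p (suc (suc (suc (suc _)))) c (s≤s (s≤s (s≤s (s≤s _)))) = refl

cell-cols : ∀ p i c → 2 < c → cell p i c ≡ false
cell-cols p 0                         (suc (suc (suc _))) (s≤s (s≤s (s≤s _))) = refl
cell-cols p 1                         (suc (suc (suc _))) (s≤s (s≤s (s≤s _))) = refl
cell-cols p 2                         (suc (suc (suc _))) (s≤s (s≤s (s≤s _))) = refl
cell-cols p 3                         (suc (suc (suc _))) (s≤s (s≤s (s≤s _))) = refl
cell-cols p (suc (suc (suc (suc _)))) (suc (suc (suc _))) (s≤s (s≤s (s≤s _))) = refl

_⊆_ : Pattern → Pattern → Set
cells a11 a21 a31 a22 a32 ⊆ cells b11 b21 b31 b22 b32 =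
  a11 B.≤ b11 × a21 B.≤ b21 × a31 B.≤ b31 × a22 B.≤ b22 × a32 B.≤ b32

cell-mono : ∀ {p q} → p ⊆ q → ∀ i c → cell p i c B.≤ cell q i c
cell-mono (h11 , _ , _ , _ , _) 1 1 = h11
cell-mono (_ , h21 , _ , _ , _) 2 1 = h21
cell-mono (_ , _ , h31 , _ , _) 3 1 = h31
cell-mono (_ , _ , _ , h22 , _) 2 2 = h22
cell-mono (_ , _ , _ , _ , h32) 3 2 = h32
cell-mono _ 0 _ = B.b≤b
cell-mono _ 1 0 = B.b≤b
cell-mono _ 1 (suc (suc _)) = B.b≤b
cell-mono _ 2 0 = B.b≤b
cell-mono _ 2 (suc (suc (suc _))) = B.b≤b
cell-mono _ 3 0 = B.b≤b
cell-mono _ 3 (suc (suc (suc _))) = B.b≤b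
cell-mono _ (suc (suc (suc (suc _)))) _ = B.b≤b

patternTriangle : {n : ℕ} (p : Pattern) → BoxConditions (cell p) → TBool n
patternTriangle p box =
  embed (cell p) , embed-valid (cell p) (box-suffices (cell p) (cell-rows p) (cell-cols p) box)

pattern-mono : {n : ℕ} {p q : Pattern} → p ⊆ q → embed {n} (cell p) ⊑ embed (cell q)
pattern-mono {n} p⊆q (idx i j _ _ _ _) = cell-mono p⊆q i (n ∸ j)

x-pattern y-pattern z₁-pattern z₂-pattern : Pattern
x-pattern  = cells true  false false false false
y-pattern  = cells false false true  false false
z₁-pattern = cells true  false true  true  false
z₂-pattern = cells true  false true  false true

X Y Z₁ Z₂ : {n : ℕ} → TBool n
X = patternTriangle x-pattern
  (by-computation , by-computation , by-computation , by-computation , by-computation)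
Y = patternTriangle y-pattern
  (by-computation , by-computation , by-computation , by-computation , by-computation)
Z₁ = patternTriangle z₁-pattern
  (by-computation , by-computation , by-computation , by-computation , by-computation)
Z₂ = patternTriangle z₂-pattern
  (by-computation , by-computation , by-computation , by-computation , by-computation)

x⊆z₁ : x-pattern ⊆ z₁-pattern
x⊆z₁ = B.b≤b , B.b≤b , B.f≤t , B.f≤t , B.b≤b

y⊆z₁ : y-pattern ⊆ z₁-pattern
y⊆z₁ = B.f≤t , B.b≤b , B.b≤b , B.f≤t , B.b≤b

x⊆z₂ : x-pattern ⊆ z₂-pattern
x⊆z₂ = B.b≤b , B.b≤b , B.f≤t , B.b≤b , B.f≤t

y⊆z₂ : y-pattern ⊆ z₂-pattern
y⊆z₂ = B.f≤t , B.b≤b , B.b≤b , B.b≤b , B.f≤t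

localIdx : {n : ℕ} (i c : ℕ) → 1 ≤ c → c ≤ i → i < n → Idx n
localIdx {n} i c 1≤c c≤i i<n =
  idx i (n ∸ c) (≤-trans 1≤c c≤i) i<n (∸-monoʳ-≤ n c≤i)
      (∸-monoʳ-< 1≤c (≤-trans c≤i (<⇒≤ i<n)))

embed-local : {n : ℕ} (P : ℕ → ℕ → Bool) (i c : ℕ) (1≤c : 1 ≤ c) (c≤i : c ≤ i) (i<n : i < n) →
              embed P (localIdx i c 1≤c c≤i i<n) ≡ P i c
embed-local P i c _ c≤i i<n = cong (P i) (m∸[m∸n]≡n (≤-trans c≤i (<⇒≤ i<n)))

forced-below : {n : ℕ} (P : ℕ → ℕ → Bool) (b : Triangle n) → embed P ⊑ b →
               (i c : ℕ) → 1 ≤ c → c ≤ i → i < n → toN (P i c) ≤ entry b i (n ∸ c)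
forced-below P b P⊑b i c 1≤c c≤i i<n = begin
    toN (P i c)    ≡⟨ cong toN (embed-local P i c 1≤c c≤i i<n) ⟨
    toN (embed P k) ≤⟨ toN-mono (P⊑b k) ⟩
    toN (b k)      ≡⟨ entry-at b k ⟨
    entry b i _    ∎
  where
    open ≤-Reasoning
    k = localIdx i c 1≤c c≤i i<n

forced-above : {n : ℕ} (P : ℕ → ℕ → Bool) (b : Triangle n) → b ⊑ embed P →
               (i c : ℕ) → 1 ≤ c → c ≤ i → i < n → entry b i (n ∸ c) ≤ toN (P i c)
forced-above P b b⊑P i c 1≤c c≤i i<n = begin
    entry b i _     ≡⟨ entry-at b k ⟩
    toN (b k)       ≤⟨ toN-mono (b⊑P k) ⟩
    toN (embed P k) ≡⟨ cong toN (embed-local P i c 1≤c c≤i i<n) ⟩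
    toN (P i c)     ∎
  where
    open ≤-Reasoning
    k = localIdx i c 1≤c c≤i i<n

-- Bounding the three-term sum sumFromTo f 1 3 below by its outer terms.
drop-middle : ∀ a b c → a + c ≤ a + (b + (c + 0))
drop-middle a b c = +-monoʳ-≤ a (≤-trans (m≤n+m c b) (+-monoʳ-≤ b (m≤m+n c 0)))

-- A valid z between X ∨ Y and Z₁ ∧ Z₂ has b₁,ₙ₋₁ = b₃,ₙ₋₁ = 1 and
-- b₂,ₙ₋₂ = b₃,ₙ₋₂ = 0, violating the condition for j = 1, i' = 3.
squeeze-impossible : {n : ℕ} → 4 ≤ n → (z : TBool n) →
  proj₁ (X {n}) ⊑ proj₁ z → proj₁ (Y {n}) ⊑ proj₁ z →
  proj₁ z ⊑ proj₁ (Z₁ {n}) → proj₁ z ⊑ proj₁ (Z₂ {n}) → ⊥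
squeeze-impossible {n} 4≤n (z , valid) X⊑z Y⊑z z⊑Z₁ z⊑Z₂ = 1+n≰n (begin
    2
  ≤⟨ +-mono-≤ (forced-below (cell x-pattern) z X⊑z 1 1 ≤-refl ≤-refl 1<n)
              (forced-below (cell y-pattern) z Y⊑z 3 1 (s≤s z≤n) (s≤s z≤n) 4≤n) ⟩
    entry z 1 (n ∸ 1) + entry z 3 (n ∸ 1)
  ≤⟨ drop-middle (entry z 1 (n ∸ 1)) (entry z 2 (n ∸ 1)) (entry z 3 (n ∸ 1)) ⟩
    sumFromTo (λ i → entry z i (n ∸ 1)) 1 3
  ≤⟨ valid 1 3 (s≤s z≤n) (s≤s z≤n) 4≤n ⟩
    1 + sumFromTo (λ i → entry z i (n ∸ 1 ∸ 1)) 2 3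
  ≡⟨ cong (λ col → 1 + (entry z 2 col + (entry z 3 col + 0))) (∸-+-assoc n 1 1) ⟩
    1 + (entry z 2 (n ∸ 2) + (entry z 3 (n ∸ 2) + 0))
  ≤⟨ +-monoʳ-≤ 1 (+-mono-≤ (forced-above (cell z₂-pattern) z z⊑Z₂ 2 2 (s≤s z≤n) ≤-refl 2<n)
                           (+-monoˡ-≤ 0 (forced-above (cell z₁-pattern) z z⊑Z₁ 3 2 (s≤s z≤n)
                                                       (s≤s (s≤s z≤n)) 4≤n))) ⟩
    1
  ∎)
  where
    open ≤-Reasoning
    1<n : 1 < n
    1<n = ≤-trans (s≤s (s≤s z≤n)) 4≤n
    2<n : 2 < n
    2<n = ≤-trans (s≤s (s≤s (s≤s z≤n))) 4≤n

no-meet : {n : ℕ} → 4 ≤ n → (z : TBool n) → ¬ IsMeet X Y z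
no-meet 4≤n z (z≼X , z≼Y , greatest) = squeeze-impossible 4≤n z z≼X z≼Y
  (greatest Z₁ (pattern-mono x⊆z₁) (pattern-mono y⊆z₁))
  (greatest Z₂ (pattern-mono x⊆z₂) (pattern-mono y⊆z₂))


proposition4p16 : ((n : ℕ) → n ≤ 3 → IsLatticeTBool n) × ((n : ℕ) → 4 ≤ n → ¬ IsLatticeTBool n)
proposition4p16 = small , large
  where
    small : (n : ℕ) → n ≤ 3 → IsLatticeTBool n
    small n n≤3 with m≤n⇒m<n∨m≡n n≤3
    ... | inj₁ n<3  = lattice≤2 n (≤-pred n<3)
    ... | inj₂ refl = lattice3
    large : (n : ℕ) → 4 ≤ n → ¬ IsLatticeTBool n
    large n 4≤n isLattice = uncurry (no-meet 4≤n) (proj₂ (isLattice X Y))
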